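{- Let $M$ be the compatible matching output by $\mathcal{LS}$ on an MCBM instance $G$ and let $M^*$ be a maximum compatible matching of $G$. For any edge $e_{i,j}\in M$ and any pair of parallel edges $e^*_{i_1,j_1}, e^*_{i_1+1,j_1+1}\in C^*(e_{i,j})$, we have $\bigl||C(e^*_{i_1,j_1})|-|C(e^*_{i_1+1,j_1+1})|\bigr|\le 2$.
   Context: MCBM: $G=(D^A,D^B,E)$ bipartite with $D^A=\{d^A_1,\dots,d^A_{n-1}\}$, $D^B=\{d^B_1,\dots,d^B_{n-1}\}$, $e_{i,j}$ the edge between $d^A_i$ and $d^B_j$. Two distinct edges conflict if (i) they share an endpoint, or (ii) they are $e_{i,j}$ and $e_{i+1,j'}$ with $j'\ne j+1$, or (iii) they are $e_{i,j}$ and $e_{i',j+1}$ with $i'\ne i+1$; otherwise compatible. A compatible matching is a set of pairwise compatible edges. Edges $e_{i,j}$ and $e_{i+1,j+1}$ are parallel; an edge of a compatible matching $M$ is a singleton if parallel to no other edge of $M$, and $s(M)$ is the set of singletons. Algorithm $\mathcal{LS}$: start from $M=\emptyset$; repeatedly (1) greedily extend $M$ to a maximal compatible matching; (2) Replace-5-by-6: if $|M|\le5$ search exhaustively for a compatible matching of size $|M|+1$; else for some $5$-element $X\subseteq M$, with $C(X)$ the set of edges conflicting with some edge of $X$ and compatible with all of $M\setminus X$, replace $X$ by a $6$-element pairwise compatible $X'\subseteq X\cup C(X)$ if one exists; (3) if (2) fails, Reduce-5-by-5: if $|M|\le 5$ search exhaustively for a compatible matching of size $|M|$ with fewer singletons;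 else replace some $5$-element $X\subseteq M$ by a $5$-element pairwise compatible $X'\subseteq X\cup C(X)$ with $|s((M\setminus X)\cup X')|<|s(M)|$ if one exists; (4) if both fail, output $M$. Notation: edges of $M^*$ are written with a superscript $*$. An edge is regarded as conflicting with itself. For $e^*\in M^*$, $C(e^*)\subseteq M$ is the set of edges of $M$ conflicting with $e^*$; for $e\in M$, $C^*(e)\subseteq M^*$ is the set of edges of $M^*$ conflicting with $e$. -}

module Defs where

open import Data.Nat using (ℕ; zero; suc; _+_; _≤_; _<_; _>_)
open import Data.Nat.Properties using (_≟_)
open import Data.Product using (_×_; _,_; ∃; ∃-syntax; Σ)
open import Data.Product.Properties using (≡-dec)
open import Data.Sum using (_⊎_; inj₁; inj₂)
open import Data.List using (List; []; _∷_; length; filter; _++_)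
open import Data.List.Relation.Unary.All using (All)
open import Data.List.Relation.Unary.Any using (Any; any?)
open import Data.List.Relation.Unary.AllPairs using (AllPairs)
open import Data.List.Relation.Unary.Unique.Propositional using (Unique)
open import Relation.Nullary using (¬_; Dec; yes; no)
open import Relation.Nullary.Decidable using (_×-dec_; _⊎-dec_; ¬?)
open import Relation.Binary.PropositionalEquality using (_≡_; _≢_)
import Data.List.Membership.DecPropositional as DecMem

-- Edges.  The edge e_{i,j} between d^A_i and d^B_j is the pair (i , j).
-- Vertex indices are 0-based: i , j ∈ {0 , … , m-1} where m = n - 1.

Edge : Set
Edge = ℕ × ℕ

_≟ₑ_ : (e f : Edge) → Dec (e ≡ f)
_≟ₑ_ = ≡-dec _≟_ _≟_

open DecMem _≟ₑ_ public using (_∈_; _∉_; _∈?_)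

record Instance : Set where
  field
    m     : ℕ
    E     : List Edge
    inRng : All (λ e → Data.Product.proj₁ e < m × Data.Product.proj₂ e < m) E

open Instance public

-- Conflict (an edge is regarded as conflicting with itself; for distinct
-- edges this is exactly conditions (i)–(iii)).

Conf : Edge → Edge → Set
Conf (i , j) (i' , j') =
  (i ≡ i' ⊎ j ≡ j')
  ⊎ ((i' ≡ suc i × j' ≢ suc j) ⊎ (i ≡ suc i' × j ≢ suc j'))
  ⊎ ((j' ≡ suc j × i' ≢ suc i) ⊎ (j ≡ suc j' × i ≢ suc i'))

conf? : (e f : Edge) → Dec (Conf e f)
conf? (i , j) (i' , j') =
  ((i ≟ i') ⊎-dec (j ≟ j'))
  ⊎-dec (((i' ≟ suc i) ×-dec ¬? (j' ≟ suc j)) ⊎-dec ((i ≟ suc i') ×-dec ¬? (j ≟ suc j')))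
  ⊎-dec (((j' ≟ suc j) ×-dec ¬? (i' ≟ suc i)) ⊎-dec ((j ≟ suc j') ×-dec ¬? (i ≟ suc i')))

Compatible : Edge → Edge → Set
Compatible e f = e ≢ f × ¬ Conf e f

Parallel : Edge → Edge → Set
Parallel (i , j) (i' , j') = (i' ≡ suc i × j' ≡ suc j) ⊎ (i ≡ suc i' × j ≡ suc j')

parallel? : (e f : Edge) → Dec (Parallel e f)
parallel? (i , j) (i' , j') =
  ((i' ≟ suc i) ×-dec (j' ≟ suc j)) ⊎-dec ((i ≟ suc i') ×-dec (j ≟ suc j'))

-- Sets of edges are duplicate-free lists.

PairwiseCompatible : List Edge → Set
PairwiseCompatible X = Unique X × AllPairs Compatible X

CM : Instance → List Edge → Set
CM G M = All (_∈ E G) M × PairwiseCompatible M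

_⊆_ : List Edge → List Edge → Set
X ⊆ Y = All (_∈ Y) X

Maximal : Instance → List Edge → Set
Maximal G M = CM G M × (∀ e → e ∈ E G → e ∉ M → ¬ CM G (e ∷ M))

Maximum : Instance → List Edge → Set
Maximum G M = CM G M × (∀ N → CM G N → length N ≤ length M)

singletons : List Edge → List Edge
singletons M = filter (λ e → ¬? (any? (parallel? e) M)) M

C : List Edge → Edge → List Edge
C M e* = filter (conf? e*) M

_∖_ : List Edge → List Edge → List Edge
M ∖ X = filter (λ e → ¬? (e ∈? X)) M

SubsetOfSize : ℕ → List Edge → List Edge → Set
SubsetOfSize k M X = Unique X × X ⊆ M × length X ≡ k

ValidReplacement : Instance → ℕ → List Edge → List Edge → List Edge → Set
ValidReplacement G k M X X' =
  PairwiseCompatible X' × length X' ≡ k ×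
  All (λ e → e ∈ X ⊎ (e ∈ E G × Any (Conf e) X × All (Compatible e) (M ∖ X))) X'

data Replace56 (G : Instance) (M : List Edge) : List Edge → Set where
  small : length M ≤ 5 → ∀ M₁ → CM G M₁ → length M₁ ≡ suc (length M) →
          Replace56 G M M₁
  large : length M > 5 → ∀ X X' → SubsetOfSize 5 M X →
          ValidReplacement G 6 M X X' →
          Replace56 G M ((M ∖ X) ++ X')

data Reduce55 (G : Instance) (M : List Edge) : List Edge → Set where
  small : length M ≤ 5 → ∀ M₁ → CM G M₁ → length M₁ ≡ length M →
          length (singletons M₁) < length (singletons M) →
          Reduce55 G M M₁
  large : length M > 5 → ∀ X X' → SubsetOfSize 5 M X →
          ValidReplacement G 5 M X X' →
          length (singletons ((M ∖ X) ++ X')) < length (singletons M) →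
          Reduce55 G M ((M ∖ X) ++ X')

-- States of LS right after step (1) (greedy extension to a maximal
-- compatible matching), over all possible runs / choices.
data Reach (G : Instance) : List Edge → Set where
  start   : ∀ M → Maximal G M → Reach G M
  replace : ∀ {M M₁ M₂} → Reach G M → Replace56 G M M₁ →
            M₁ ⊆ M₂ → Maximal G M₂ → Reach G M₂
  reduce  : ∀ {M M₁ M₂} → Reach G M → (∀ N → ¬ Replace56 G M N) →
            Reduce55 G M M₁ → M₁ ⊆ M₂ → Maximal G M₂ → Reach G M₂

LSOutput : Instance → List Edge → Set
LSOutput G M = Reach G M × (∀ N → ¬ Replace56 G M N) × (∀ N → ¬ Reduce55 G M N)

module Submission where

-- Write e = e*_{i₁,j₁} and f = e*_{i₁+1,j₁+1}.  Every edge of M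
-- conflicting with e either conflicts with f as well, or lies in the set
-- D(e,f) of edges conflicting with e but not with f; hence
--   |C(e)| ≤ |C(f)| + |C(e) ∩ D(e,f)|.
-- For parallel e, f the set D(e,f) is covered by two "conflict cliques"
-- (sets of pairwise conflicting edges): e together with the edges one row
-- below e that are not parallel to it, and the edges one column below e.
-- The same holds for D(f,e), mirrored to the other side of f.  A pairwise
-- compatible set meets each clique at most once, so it has at most two
-- edges in D(e,f).  Applying this to M gives both inequalities.

open import Defs
open import Data.Nat using (ℕ; suc; _+_; _≤_; z≤n; s≤s)
open import Data.Nat.Properties using (≤-trans; +-suc; n≤1+n; +-monoʳ-≤; suc-injective; _≟_)
open import Data.Product using (_×_; _,_; proj₁; proj₂)
open import Data.Sum using (_⊎_; inj₁; inj₂)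
open import Data.List using (List; []; _∷_; length; filter)
open import Data.List.Relation.Unary.All using (All; []; _∷_)
open import Data.List.Relation.Unary.AllPairs using (AllPairs; []; _∷_)
open import Data.List.Relation.Unary.All.Properties using (all-filter)
open import Data.List.Relation.Unary.AllPairs.Properties using (filter⁺)
open import Data.Empty using (⊥-elim)
open import Relation.Nullary using (¬_; yes; no)
open import Relation.Nullary.Decidable using (_×-dec_; ¬?)
open import Relation.Binary.PropositionalEquality using (_≡_; _≢_; refl; sym; trans)
open import Relation.Unary using (Pred; Decidable)
open import Level using (0ℓ)

conf-sym : ∀ {e f} → Conf e f → Conf f e
conf-sym (inj₁ (inj₁ p))        = inj₁ (inj₁ (sym p))
conf-sym (inj₁ (inj₂ q))        = inj₁ (inj₂ (sym q))
conf-sym (inj₂ (inj₁ (inj₁ r))) = inj₂ (inj₁ (inj₂ r))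
conf-sym (inj₂ (inj₁ (inj₂ r))) = inj₂ (inj₁ (inj₁ r))
conf-sym (inj₂ (inj₂ (inj₁ r))) = inj₂ (inj₂ (inj₂ r))
conf-sym (inj₂ (inj₂ (inj₂ r))) = inj₂ (inj₂ (inj₁ r))

ConflictClique : Pred Edge 0ℓ → Set
ConflictClique K = ∀ {x y} → K x → K y → Conf x y

record TwoCliqueCover (S : Pred Edge 0ℓ) : Set₁ where
  field
    K₁ K₂   : Pred Edge 0ℓ
    clique₁ : ConflictClique K₁
    clique₂ : ConflictClique K₂
    cover   : ∀ {g} → S g → K₁ g ⊎ K₂ g

-- Pigeonhole: a pairwise compatible list inside the union of two conflict
-- cliques has at most two elements, since among any three of its members
-- two lie in the same clique and therefore conflict.
compatible-in-cover : ∀ {S} → TwoCliqueCover S →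
  ∀ L → All S L → AllPairs Compatible L → length L ≤ 2
compatible-in-cover {S} cov = bound
  where
  open TwoCliqueCover cov

  pigeonhole : ∀ {x y z} → K₁ x ⊎ K₂ x → K₁ y ⊎ K₂ y → K₁ z ⊎ K₂ z →
    Conf x y ⊎ Conf x z ⊎ Conf y z
  pigeonhole (inj₁ x) (inj₁ y) _        = inj₁ (clique₁ x y)
  pigeonhole (inj₂ x) (inj₂ y) _        = inj₁ (clique₂ x y)
  pigeonhole (inj₁ x) (inj₂ _) (inj₁ z) = inj₂ (inj₁ (clique₁ x z))
  pigeonhole (inj₂ x) (inj₁ _) (inj₂ z) = inj₂ (inj₁ (clique₂ x z))
  pigeonhole (inj₁ _) (inj₂ y) (inj₂ z) = inj₂ (inj₂ (clique₂ y z))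
  pigeonhole (inj₂ _) (inj₁ y) (inj₁ z) = inj₂ (inj₂ (clique₁ y z))

  bound : ∀ L → All S L → AllPairs Compatible L → length L ≤ 2
  bound []              _ _ = z≤n
  bound (_ ∷ [])        _ _ = s≤s z≤n
  bound (_ ∷ _ ∷ [])    _ _ = s≤s (s≤s z≤n)
  bound (_ ∷ _ ∷ _ ∷ _) (sx ∷ sy ∷ sz ∷ _) ((cxy ∷ cxz ∷ _) ∷ (cyz ∷ _) ∷ _)
    with pigeonhole (cover sx) (cover sy) (cover sz)
  ... | inj₁ c        = ⊥-elim (proj₂ cxy c)
  ... | inj₂ (inj₁ c) = ⊥-elim (proj₂ cxz c)
  ... | inj₂ (inj₂ c) = ⊥-elim (proj₂ cyz c)

length-filter-≤-difference : {P Q : Pred Edge 0ℓ} (P? : Decidable P) (Q? : Decidable Q) →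
  ∀ L → length (filter P? L) ≤ length (filter Q? L) + length (filter (λ g → P? g ×-dec ¬? (Q? g)) L)
length-filter-≤-difference P? Q? [] = z≤n
length-filter-≤-difference P? Q? (x ∷ L) with P? x | Q? x
... | yes _ | yes _ = s≤s (length-filter-≤-difference P? Q? L)
... | yes _ | no _  rewrite +-suc (length (filter Q? L)) (length (filter (λ g → P? g ×-dec ¬? (Q? g)) L))
                    = s≤s (length-filter-≤-difference P? Q? L)
... | no _  | yes _ = ≤-trans (length-filter-≤-difference P? Q? L) (n≤1+n _)
... | no _  | no _  = length-filter-≤-difference P? Q? L

conflict-count-bound : ∀ {M e f} → AllPairs Compatible M →
  TwoCliqueCover (λ g → Conf e g × ¬ Conf f g) →
  length (C M e) ≤ length (C M f) + 2
conflict-count-bound {M} {e} {f} compat cov =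
  ≤-trans (length-filter-≤-difference (conf? e) (conf? f) M)
    (+-monoʳ-≤ (length (C M f))
      (compatible-in-cover cov _ (all-filter only? M) (filter⁺ only? compat)))
  where
  only? : Decidable (λ g → Conf e g × ¬ Conf f g)
  only? g = conf? e g ×-dec ¬? (conf? f g)

-- For parallel e = e_{i,j}, f = e_{i+1,j+1}: an edge conflicting with e but
-- not with f is e itself, an edge e_{i-1,b} with b ≠ j-1, or an edge
-- e_{a,j-1}.
lower-only-cover : ∀ i j →
  TwoCliqueCover (λ g → Conf (i , j) g × ¬ Conf (suc i , suc j) g)
lower-only-cover i j = record
  { K₁ = K₁ ; K₂ = K₂ ; clique₁ = clique₁ ; clique₂ = clique₂ ; cover = cover }
  where
  K₁ K₂ : Pred Edge 0ℓ
  K₁ (a , b) = (a , b) ≡ (i , j) ⊎ (i ≡ suc a × j ≢ suc b)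
  K₂ (a , b) = j ≡ suc b

  clique₁ : ConflictClique K₁
  clique₁ {_ , _} {_ , _} (inj₁ refl) (inj₁ refl) = inj₁ (inj₁ refl)
  clique₁ {_ , _} {_ , _} (inj₁ refl) (inj₂ t)    = inj₂ (inj₁ (inj₂ t))
  clique₁ {_ , _} {_ , _} (inj₂ t)    (inj₁ refl) = conf-sym (inj₂ (inj₁ (inj₂ t)))
  clique₁ {_ , _} {_ , _} (inj₂ (p , _)) (inj₂ (p' , _)) =
    inj₁ (inj₁ (suc-injective (trans (sym p) p')))

  clique₂ : ConflictClique K₂
  clique₂ {_ , _} {_ , _} q q' = inj₁ (inj₂ (suc-injective (trans (sym q) q')))

  cover : ∀ {g} → Conf (i , j) g × ¬ Conf (suc i , suc j) g → K₁ g ⊎ K₂ g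
  cover {a , b} (inj₁ (inj₁ refl) , nc) with b ≟ j
  ... | yes refl = inj₁ (inj₁ refl)
  ... | no b≢j   = ⊥-elim (nc (inj₂ (inj₁ (inj₂ (refl , λ e → b≢j (sym (suc-injective e)))))))
  cover {a , b} (inj₁ (inj₂ refl) , nc) with a ≟ i
  ... | yes refl = inj₁ (inj₁ refl)
  ... | no a≢i   = ⊥-elim (nc (inj₂ (inj₂ (inj₂ (refl , λ e → a≢i (sym (suc-injective e)))))))
  cover (inj₂ (inj₁ (inj₁ (p , _))) , nc) = ⊥-elim (nc (inj₁ (inj₁ (sym p))))
  cover (inj₂ (inj₁ (inj₂ t)) , _)        = inj₁ (inj₂ t)
  cover (inj₂ (inj₂ (inj₁ (q , _))) , nc) = ⊥-elim (nc (inj₁ (inj₂ (sym q))))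
  cover (inj₂ (inj₂ (inj₂ (q , _))) , _)  = inj₂ q

upper-only-cover : ∀ i j →
  TwoCliqueCover (λ g → Conf (suc i , suc j) g × ¬ Conf (i , j) g)
upper-only-cover i j = record
  { K₁ = K₁ ; K₂ = K₂ ; clique₁ = clique₁ ; clique₂ = clique₂ ; cover = cover }
  where
  K₁ K₂ : Pred Edge 0ℓ
  K₁ (a , b) = (a , b) ≡ (suc i , suc j) ⊎ (a ≡ suc (suc i) × b ≢ suc (suc j))
  K₂ (a , b) = b ≡ suc (suc j)

  clique₁ : ConflictClique K₁
  clique₁ {_ , _} {_ , _} (inj₁ refl) (inj₁ refl) = inj₁ (inj₁ refl)
  clique₁ {_ , _} {_ , _} (inj₁ refl) (inj₂ t)    = inj₂ (inj₁ (inj₁ t))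
  clique₁ {_ , _} {_ , _} (inj₂ t)    (inj₁ refl) = conf-sym (inj₂ (inj₁ (inj₁ t)))
  clique₁ {_ , _} {_ , _} (inj₂ (p , _)) (inj₂ (p' , _)) = inj₁ (inj₁ (trans p (sym p')))

  clique₂ : ConflictClique K₂
  clique₂ {_ , _} {_ , _} q q' = inj₁ (inj₂ (trans q (sym q')))

  cover : ∀ {g} → Conf (suc i , suc j) g × ¬ Conf (i , j) g → K₁ g ⊎ K₂ g
  cover {a , b} (inj₁ (inj₁ refl) , nc) with b ≟ suc j
  ... | yes refl = inj₁ (inj₁ refl)
  ... | no b≢    = ⊥-elim (nc (inj₂ (inj₁ (inj₁ (refl , b≢)))))
  cover {a , b} (inj₁ (inj₂ refl) , nc) with a ≟ suc i
  ... | yes refl = inj₁ (inj₁ refl)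
  ... | no a≢    = ⊥-elim (nc (inj₂ (inj₂ (inj₁ (refl , a≢)))))
  cover (inj₂ (inj₁ (inj₁ t)) , _)        = inj₁ (inj₂ t)
  cover (inj₂ (inj₁ (inj₂ (p , _))) , nc) = ⊥-elim (nc (inj₁ (inj₁ (suc-injective p))))
  cover (inj₂ (inj₂ (inj₁ (q , _))) , _)  = inj₂ q
  cover (inj₂ (inj₂ (inj₂ (q , _))) , nc) = ⊥-elim (nc (inj₁ (inj₂ (suc-injective q))))

reach-pairwise-compatible : ∀ {G M} → Reach G M → AllPairs Compatible M
reach-pairwise-compatible (start _ maximal)         = proj₂ (proj₂ (proj₁ maximal))
reach-pairwise-compatible (replace _ _ _ maximal)   = proj₂ (proj₂ (proj₁ maximal))
reach-pairwise-compatible (reduce _ _ _ _ maximal)  = proj₂ (proj₂ (proj₁ maximal))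

lemma4p2 : (G : Instance) (M M* : List Edge) →
    LSOutput G M → Maximum G M* →
    ∀ (i j i₁ j₁ : ℕ) → (i , j) ∈ M →
    (i₁ , j₁) ∈ M* → (suc i₁ , suc j₁) ∈ M* →
    Conf (i₁ , j₁) (i , j) → Conf (suc i₁ , suc j₁) (i , j) →
    length (C M (i₁ , j₁)) ≤ length (C M (suc i₁ , suc j₁)) + 2 ×
    length (C M (suc i₁ , suc j₁)) ≤ length (C M (i₁ , j₁)) + 2
lemma4p2 G M M* output _ i j i₁ j₁ _ _ _ _ _ =
  conflict-count-bound compatible (lower-only-cover i₁ j₁) ,
  conflict-count-bound compatible (upper-only-cover i₁ j₁)
  where
  compatible : AllPairs Compatible M
  compatible = reach-pairwise-compatible (proj₁ output)
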